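{- Let $n\ge 1$, let $\mathbb{F}$ be a field, let $1\le m\le n-1$, and let $\alpha$ be an anti-chain of size $m$ in $[n]\times[m]$. The association scheme $\mathfrak{X}_\alpha=(\mathcal{O}_\alpha,\{\mathcal{R}_{\alpha,\beta}\}_\beta)$, where $\beta$ runs over all anti-chains in $\mathcal{D}(\alpha)$, is symmetric; that is, for every such $\beta$ and all $M,N\in\mathcal{O}_\alpha$, $(M,N)\in\mathcal{R}_{\alpha,\beta}$ if and only if $(N,M)\in\mathcal{R}_{\alpha,\beta}$.
   Context: $[k]=\{1,\dots,k\}$. A matrix in $\mathrm{Mat}_n(\mathbb{F})$ is in reduced reverse column echelon form if: (CE1) any zero columns lie to the right of all nonzero columns; (CE2) the last (lowest) nonzero entry of a nonzero column lies strictly below the last nonzero entry of the column immediately to its right (whenever that column is nonzero); (CE3) every last nonzero entry of a nonzero column equals $1$ and is the only nonzero entry in its row. Order $[n]\times[n]$ by $(i,j)\le(k,l)$ iff $i\le k$ and $j\le l$; an anti-chain is a set of pairwise incomparable elements; $\mathrm{Down}(Y)=\{x: x<y \text{ for some } y\in Y\}$. $\mathrm{Piv}(M)$ is the set of maximal elements of $\{(i,j): M_{i,j}\ne0\}$. $\mathcal{O}_\alpha$ is the set of reduced reverse column echelon matrices $M$ with $\mathrm{Piv}(M)=\alpha$ (a Schubert cell of the Grassmannian of $m$-dimensional subspaces of $\mathbb{F}^n$, identified via column spaces). $\mathcal{D}(\alpha)=\{(i,j)\in\mathrm{Down}(\alpha):\text{there is no } k \text{ with } (i,k)\in\alpha\}$.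 For an anti-chain $\beta\subseteq\mathcal{D}(\alpha)$, $\mathcal{R}_{\alpha,\beta}=\{(M,N)\in\mathcal{O}_\alpha\times\mathcal{O}_\alpha:\mathrm{Piv}(M-N)=\beta\}$. These relations are exactly the orbitals of the action of the group of invertible upper triangular matrices on $\mathcal{O}_\alpha$, so $\mathfrak{X}_\alpha$ is an association scheme. -}

module Defs where

open import Level using (Level; _⊔_; suc)
open import Algebra.Bundles using (CommutativeRing)
open import Data.Nat using (ℕ) renaming (suc to sucℕ; _<_ to _<ℕ_)
open import Data.Fin using (Fin; toℕ; _≤_; _<_)
open import Data.Product using (_×_; _,_; Σ; ∃)
open import Data.List using (List; length)
open import Data.List.Membership.Propositional using (_∈_)
open import Data.List.Relation.Unary.Unique.Propositional using (Unique)
open import Relation.Binary.PropositionalEquality using (_≡_)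
open import Relation.Nullary using (¬_)

record Field (c ℓ : Level) : Set (suc (c ⊔ ℓ)) where
  field
    commutativeRing : CommutativeRing c ℓ
  open CommutativeRing commutativeRing public
  field
    0≉1     : ¬ (0# ≈ 1#)
    inverse : ∀ x → ¬ (x ≈ 0#) → Σ Carrier (λ y → (x * y) ≈ 1#)

-- Positions in [n]×[n] (0-indexed via Fin n).
Pos : ℕ → Set
Pos n = Fin n × Fin n

_≼_ : ∀ {n} → Pos n → Pos n → Set
(i , j) ≼ (k , l) = (i ≤ k) × (j ≤ l)

_≺_ : ∀ {n} → Pos n → Pos n → Set
x ≺ y = (x ≼ y) × ¬ (x ≡ y)

-- Finite subsets of positions are represented as duplicate-free lists.
IsAntiChain : ∀ {n} → List (Pos n) → Set
IsAntiChain Y = ∀ {x y} → x ∈ Y → y ∈ Y → x ≼ y → x ≡ y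

InDown : ∀ {n} → List (Pos n) → Pos n → Set
InDown Y x = ∃ λ y → (y ∈ Y) × (x ≺ y)

InD : ∀ {n} → List (Pos n) → Pos n → Set
InD α (i , j) = InDown α (i , j) × (∀ k → ¬ ((i , k) ∈ α))

_≐_ : ∀ {p} {n} → (Pos n → Set p) → List (Pos n) → Set p
P ≐ Y = ∀ x → (P x → x ∈ Y) × (x ∈ Y → P x)

module Matrices {c ℓ : Level} (F : Field c ℓ) where
  open Field F

  Mat : ℕ → Set c
  Mat n = Fin n → Fin n → Carrier

  _-ᴹ_ : ∀ {n} → Mat n → Mat n → Mat n
  (M -ᴹ N) i j = M i j - N i j

  NonZero : Carrier → Set ℓ
  NonZero x = ¬ (x ≈ 0#)

  ZeroCol : ∀ {n} → Mat n → Fin n → Set ℓ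
  ZeroCol M j = ∀ i → M i j ≈ 0#

  LastNZ : ∀ {n} → Mat n → Fin n → Fin n → Set ℓ
  LastNZ M i j = NonZero (M i j) × (∀ i' → i < i' → M i' j ≈ 0#)

  record IsRRCEF {n} (M : Mat n) : Set ℓ where
    field
      ce1 : ∀ j j' → j < j' → ZeroCol M j → ZeroCol M j'
      ce2 : ∀ j j' → toℕ j' ≡ sucℕ (toℕ j) → ∀ i i' →
            LastNZ M i j → LastNZ M i' j' → i' < i
      ce3 : ∀ i j → LastNZ M i j → (M i j ≈ 1#) × (∀ j' → ¬ (j' ≡ j) → M i j' ≈ 0#)

  InPiv : ∀ {n} → Mat n → Pos n → Set ℓ
  InPiv M (i , j) = NonZero (M i j) × (∀ k l → (i , j) ≺ (k , l) → ¬ NonZero (M k l))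

  InO : ∀ {n} → List (Pos n) → Mat n → Set ℓ
  InO α M = IsRRCEF M × (InPiv M ≐ α)

  InR : ∀ {n} → List (Pos n) → List (Pos n) → Mat n → Mat n → Set ℓ
  InR α β M N = InO α M × InO α N × (InPiv (M -ᴹ N) ≐ β)

-- Negating a matrix does not change its support, so Piv(M − N) = Piv(N − M),
-- hence ℛ_{α,β} is symmetric; none of the hypotheses on n, m, α, β is needed.
module Submission where

open import Defs
open import Level using (Level)
open import Data.Nat using (ℕ; _≤_; _<_; _∸_)
open import Data.Fin using (toℕ)
open import Data.Product using (_×_; _,_; proj₁; proj₂)
open import Data.List using (List; length)
open import Data.List.Relation.Unary.All using (All)
open import Data.List.Relation.Unary.Unique.Propositional using (Unique)
open import Function.Bundles using (_⇔_; mk⇔)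
open import Relation.Binary.PropositionalEquality using (_≡_)
import Algebra.Properties.Group as GroupProperties

module _ {c ℓ : Level} (F : Field c ℓ) where
  open Field F
  open Matrices F
  open GroupProperties +-group using (x∙y⁻¹≈ε⇒x≈y; x≈y⇒x∙y⁻¹≈ε)

  nonZero-−-comm : ∀ x y → NonZero (x - y) → NonZero (y - x)
  nonZero-−-comm x y x-y≉0 y-x≈0 = x-y≉0 (x≈y⇒x∙y⁻¹≈ε (sym (x∙y⁻¹≈ε⇒x≈y y x y-x≈0)))

  InPiv-−ᴹ-comm : ∀ {n} (M N : Mat n) p → InPiv (M -ᴹ N) p → InPiv (N -ᴹ M) p
  InPiv-−ᴹ-comm M N (i , j) (nz , maximal) =
    nonZero-−-comm (M i j) (N i j) nz ,
    λ k l ij≺kl nz′ → maximal k l ij≺kl (nonZero-−-comm (N k l) (M k l) nz′)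

  InR-sym : ∀ {n} (α β : List (Pos n)) M N → InR α β M N → InR α β N M
  InR-sym α β M N (M∈𝒪 , N∈𝒪 , Piv[M-N]≐β) = N∈𝒪 , M∈𝒪 , λ p →
    (λ p∈Piv → proj₁ (Piv[M-N]≐β p) (InPiv-−ᴹ-comm N M p p∈Piv)) ,
    (λ p∈β → InPiv-−ᴹ-comm M N p (proj₂ (Piv[M-N]≐β p) p∈β))

theorem4p1 : ∀ {c ℓ : Level} (F : Field c ℓ) (n m : ℕ) → 1 ≤ n → 1 ≤ m → m ≤ n ∸ 1 →
    (α : List (Pos n)) → Unique α → length α ≡ m → All (λ p → toℕ (proj₂ p) < m) α → IsAntiChain α →
    (β : List (Pos n)) → Unique β → IsAntiChain β → All (InD α) β →
    ∀ M N → Matrices.InO F α M → Matrices.InO F α N →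
    Matrices.InR F α β M N ⇔ Matrices.InR F α β N M
theorem4p1 F n m _ _ _ α _ _ _ _ β _ _ _ M N _ _ = mk⇔ (InR-sym F α β M N) (InR-sym F α β N M)
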